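{- Let $n$ be a nonsquare positive integer. Let $k,k',m$ be positive integers such that $$k<\sqrt n\quad\text{and}\quad m^2-n=\varepsilon kk',\quad\text{where }\varepsilon=\pm1.$$ Then the following are equivalent: (1) $m$ is best mod $k$; (2) $k'^2+k^2/4\le n$; (3) $m\ge k'+\varepsilon k/2$. Moreover, the inequalities in (2) and (3) are strict if and only if $m$ is strictly best mod $k$.
   Context: Throughout, $n$ is a fixed nonsquare positive integer. A positive integer $m$ is called best mod $k$ if for every positive integer $m'$ with $m'\equiv m \pmod k$ one has $|m^2-n|\le|m'^2-n|$. It is called strictly best mod $k$ if it is best mod $k$ and it is the only positive integer in its congruence class mod $k$ that is best mod $k$. -}

module Defs where

open import Data.Nat using (ℕ; _≤_; _<_)
open import Data.Integer as ℤ using (ℤ; +_; ∣_∣; _-_)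
open import Data.Integer.Divisibility using (_∣_)
open import Data.Product using (_×_)
open import Relation.Binary.PropositionalEquality using (_≡_)

_≡_[mod_] : ℕ → ℕ → ℕ → Set
a ≡ b [mod k ] = (+ k) ∣ (+ a - + b)

dist : ℕ → ℕ → ℕ
dist n m = ∣ (+ m) ℤ.* (+ m) - + n ∣

Best : ℕ → ℕ → ℕ → Set
Best n k m = ∀ (m' : ℕ) → 0 < m' → m' ≡ m [mod k ] → dist n m ≤ dist n m'

StrictlyBest : ℕ → ℕ → ℕ → Set
StrictlyBest n k m = Best n k m × (∀ (m' : ℕ) → 0 < m' → m' ≡ m [mod k ] → Best n k m' → m' ≡ m)

module Submission where

open import Defs
open import Data.Nat as ℕ using (ℕ)
open import Data.Integer as ℤ using (ℤ; +_; -_; _-_)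
open import Data.Product using (_×_)
open import Data.Sum using (_⊎_)
open import Function.Bundles using (_⇔_)
open import Relation.Binary.PropositionalEquality using (_≡_; _≢_)

open import Data.Integer using (0ℤ; _+_; _*_; _≤_; _<_; +≤+; +<+; -≤+; ∣_∣; -[1+_])
import Data.Integer.Properties as ℤP
import Data.Integer.Divisibility.Signed as ℤD
open import Data.Integer.Tactic.RingSolver using (solve-∀)
import Data.Nat.Properties as ℕP
import Data.Nat.Divisibility as ℕD
open import Data.Product using (Σ; _,_; proj₁; proj₂)
open import Data.Sum as Sum using (inj₁; inj₂)
open import Data.Empty using (⊥-elim)
open import Relation.Nullary using (yes; no)
open import Relation.Binary.PropositionalEquality
  using (refl; sym; trans; cong; cong₂; subst; subst₂; module ≡-Reasoning)
open import Function.Bundles using (mk⇔)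
open import Function.Base using (_∘′_)
import Function.Properties.Equivalence as ⇔

-- Write δ(x) = x² − n, so that dist n x = |δ(x)| and δ(m) = εkk'.  Two numbers
-- govern the proof: the neighbour y = m − εk of m in its class (lying on the
-- side of √n), and the slack c = 2m − (2k' + εk) of condition (3).  By the
-- identities  −εδ(y) = k(k' + c)  and  4n − (4k'² + k²) = c(2m + 2k' + εk):
--
-- 1. Any other positive x ≡ m (mod k) is at distance ≥ k from m, so it lies
--    beyond m, where |δ(x)| ≥ εδ(x) > εδ(m) = kk', or beyond y, where
--    |δ(x)| ≥ −εδ(x) ≥ −εδ(y) = k(k' + c).  Hence c ≥ 0 makes m best and
--    c > 0 makes it strictly best.
-- 2. Conversely y is a positive member of the class (for ε = 1 because
--    k² < n < m²) with |δ(y)| = k|k' + c| and k' + c > −k'; comparing with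
--    |δ(m)| = kk' forces c ≥ 0 if m is best and c > 0 if it is strictly best.
-- 3. The cofactor 2m + 2k' + εk is positive (for ε = −1 because k² < n), so
--    c has the sign of 4n − (4k'² + k²): conditions (2) and (3) agree.

≤-by-gap : ∀ {i j} d → j - i ≡ d → 0ℤ ≤ d → i ≤ j
≤-by-gap d eq 0≤d = ℤP.0≤i-j⇒j≤i (subst (0ℤ ≤_) (sym eq) 0≤d)

<-by-gap : ∀ {i j} d → j - i ≡ d → 0ℤ < d → i < j
<-by-gap {i} {j} d eq 0<d =
  subst₂ _<_ (ℤP.+-identityʳ i) (cancel i j) (ℤP.+-monoʳ-< i (subst (0ℤ <_) (sym eq) 0<d))
  where
  cancel : ∀ i j → i + (j - i) ≡ j
  cancel = solve-∀

gap-of-< : ∀ {i j} → i < j → 0ℤ < j - i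
gap-of-< {i} {j} i<j = subst (_< j - i) (ℤP.+-inverseʳ i) (ℤP.+-monoˡ-< (- i) i<j)

≤⇔0≤gap : ∀ {i j} → (0ℤ ≤ j - i) ⇔ (i ≤ j)
≤⇔0≤gap = mk⇔ ℤP.0≤i-j⇒j≤i ℤP.i≤j⇒0≤j-i

<⇔0<gap : ∀ {i j} → (0ℤ < j - i) ⇔ (i < j)
<⇔0<gap = mk⇔ (<-by-gap _ refl) gap-of-<

*-nonNeg : ∀ {a b} → 0ℤ ≤ a → 0ℤ ≤ b → 0ℤ ≤ a * b
*-nonNeg {+ x} {+ y} (+≤+ _) (+≤+ _) = subst (0ℤ ≤_) (ℤP.pos-* x y) (+≤+ ℕ.z≤n)

*-pos : ∀ {a b} → 0ℤ < a → 0ℤ < b → 0ℤ < a * b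
*-pos (+<+ (ℕ.s≤s _)) (+<+ (ℕ.s≤s _)) = +<+ (ℕ.s≤s ℕ.z≤n)

0≤pos : ∀ x → 0ℤ ≤ + x
0≤pos _ = +≤+ ℕ.z≤n

sign-of-product : ∀ {g c} → 0ℤ < g → (0ℤ ≤ c * g ⇔ 0ℤ ≤ c) × (0ℤ < c * g ⇔ 0ℤ < c)
sign-of-product {g} {c} (+<+ (ℕ.s≤s _)) =
  mk⇔ (ℤP.*-cancelʳ-≤-pos 0ℤ c g) (ℤP.*-monoʳ-≤-nonNeg g) ,
  mk⇔ (ℤP.*-cancelʳ-<-nonNeg g) (ℤP.*-monoʳ-<-pos g)

i≤∣i∣ : ∀ i → i ≤ + ∣ i ∣
i≤∣i∣ (+ _) = ℤP.≤-refl
i≤∣i∣ -[1+ _ ] = -≤+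

abs-unit-* : ∀ s → ∣ s ∣ ≡ 1 → ∀ i → ∣ s * i ∣ ≡ ∣ i ∣
abs-unit-* s s1 i = trans (ℤP.abs-* s i) (trans (cong (ℕ._* ∣ i ∣) s1) (ℕP.*-identityˡ ∣ i ∣))

unit-*-≤-abs : ∀ s → ∣ s ∣ ≡ 1 → ∀ i → s * i ≤ + ∣ i ∣
unit-*-≤-abs s s1 i = subst (s * i ≤_) (cong +_ (abs-unit-* s s1 i)) (i≤∣i∣ (s * i))

add-sub-cancel : ∀ a c → (a + c) - a ≡ c
add-sub-cancel = solve-∀

nonNeg-shift : ∀ a c → a ≤ + ∣ a + c ∣ → - a < a + c → 0ℤ ≤ c
nonNeg-shift a c a≤ above = Sum.[ nonNeg , negative ] (ℤP.+∣i∣≡i⊎+∣i∣≡-i (a + c))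
  where
  nonNeg : + ∣ a + c ∣ ≡ a + c → 0ℤ ≤ c
  nonNeg e = subst (0ℤ ≤_) (add-sub-cancel a c) (ℤP.i≤j⇒0≤j-i (subst (a ≤_) e a≤))
  negative : + ∣ a + c ∣ ≡ - (a + c) → 0ℤ ≤ c
  negative e = ⊥-elim (ℤP.<⇒≱ above
    (subst (_≤ - a) (ℤP.neg-involutive (a + c)) (ℤP.neg-mono-≤ (subst (a ≤_) e a≤))))

pos-shift : ∀ a c → a < + ∣ a + c ∣ → - a < a + c → 0ℤ < c
pos-shift a c a< above = Sum.[ positive , negative ] (ℤP.+∣i∣≡i⊎+∣i∣≡-i (a + c))
  where
  positive : + ∣ a + c ∣ ≡ a + c → 0ℤ < c
  positive e = subst (0ℤ <_) (add-sub-cancel a c) (gap-of-< (subst (a <_) e a<))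
  negative : + ∣ a + c ∣ ≡ - (a + c) → 0ℤ < c
  negative e = ⊥-elim (ℤP.<⇒≱ above
    (subst (_≤ - a) (ℤP.neg-involutive (a + c))
      (ℤP.neg-mono-≤ (ℤP.<⇒≤ (subst (a <_) e a<)))))

square-difference : ∀ s a b c → s * (a * a - c) - s * (b * b - c) ≡ s * (a - b) * (a + b)
square-difference = solve-∀

scaled-square-≤ : ∀ s a b c → 0ℤ ≤ s * (a - b) → 0ℤ ≤ a + b → s * (b * b - c) ≤ s * (a * a - c)
scaled-square-≤ s a b c p q = ≤-by-gap _ (square-difference s a b c) (*-nonNeg p q)

scaled-square-< : ∀ s a b c → 0ℤ < s * (a - b) → 0ℤ < a + b → s * (b * b - c) < s * (a * a - c)
scaled-square-< s a b c p q = <-by-gap _ (square-difference s a b c) (*-pos p q)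

below-root : ∀ {n k m} → k ℕ.* k ℕ.< n → n ℕ.< m ℕ.* m → k ℕ.< m
below-root k²<n n<m² =
  ℕP.≰⇒> λ m≤k → ℕP.<⇒≱ (ℕP.<-trans k²<n n<m²) (ℕP.*-mono-≤ m≤k m≤k)

mod-sym : ∀ {a b k} → a ≡ b [mod k ] → b ≡ a [mod k ]
mod-sym {a} {b} {k} = subst (k ℕD.∣_) (ℤP.∣i-j∣≡∣j-i∣ (+ a) (+ b))

mod-trans : ∀ {a b c k} → a ≡ b [mod k ] → b ≡ c [mod k ] → a ≡ c [mod k ]
mod-trans {a} {b} {c} {k} p q = ℤD.∣⇒∣ᵤ
  (subst ((+ k) ℤD.∣_) (telescope (+ a) (+ b) (+ c))
    (ℤD.∣m∣n⇒∣m+n (ℤD.∣ᵤ⇒∣ {+ k} {+ a - + b} p) (ℤD.∣ᵤ⇒∣ {+ k} {+ b - + c} q)))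
  where
  telescope : ∀ a b c → (a - b) + (b - c) ≡ a - c
  telescope = solve-∀

mod-of-distance : ∀ {a b k} → ∣ + a - + b ∣ ≡ k → a ≡ b [mod k ]
mod-of-distance {k = k} e = subst (k ℕD.∣_) (sym e) ℕD.∣-refl

class-gap : ∀ {a b k} → a ≡ b [mod k ] → a ≢ b → + k ≤ + a - + b ⊎ + k ≤ - (+ a - + b)
class-gap {a} {b} {k} ab a≢b =
  Sum.map (λ e → subst (+ k ≤_) e k≤∣a-b∣) (λ e → subst (+ k ≤_) e k≤∣a-b∣)
    (ℤP.+∣i∣≡i⊎+∣i∣≡-i (+ a - + b))
  where
  ∣a-b∣≢0 : ∣ + a - + b ∣ ≢ 0
  ∣a-b∣≢0 e = a≢b (ℤP.+-injective (ℤP.i-j≡0⇒i≡j (+ a) (+ b) (ℤP.∣i∣≡0⇒i≡0 e)))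
  k≤∣a-b∣ : + k ≤ + ∣ + a - + b ∣
  k≤∣a-b∣ = +≤+ (ℕD.∣⇒≤ {{ℕ.≢-nonZero ∣a-b∣≢0}} ab)

module _ {n k m : ℕ} where

  best-transfer : ∀ y → Best n k m → y ≡ m [mod k ] → dist n y ℕ.≤ dist n m → Best n k y
  best-transfer y best ym y≤m x 0<x xy = ℕP.≤-trans y≤m (best x 0<x (mod-trans {x} {y} {m} xy ym))

  best-intro : (∀ x → 0 ℕ.< x → x ≡ m [mod k ] → x ≢ m → dist n m ℕ.≤ dist n x) → Best n k m
  best-intro closer x 0<x xm with x ℕ.≟ m
  ... | yes refl = ℕP.≤-refl
  ... | no x≢m = closer x 0<x xm x≢m

  strictlyBest-intro : 0 ℕ.< m →
    (∀ x → 0 ℕ.< x → x ≡ m [mod k ] → x ≢ m → dist n m ℕ.< dist n x) → StrictlyBest n k m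
  strictlyBest-intro 0<m closer = best-intro (λ x 0<x xm x≢m → ℕP.<⇒≤ (closer x 0<x xm x≢m)) , unique
    where
    unique : ∀ x → 0 ℕ.< x → x ≡ m [mod k ] → Best n k x → x ≡ m
    unique x 0<x xm best-x with x ℕ.≟ m
    ... | yes x≡m = x≡m
    ... | no x≢m = ⊥-elim (ℕP.<⇒≱ (closer x 0<x xm x≢m) (best-x m 0<m (mod-sym {x} {m} xm)))

  strictlyBest-beats : ∀ {y} → StrictlyBest n k m → 0 ℕ.< y → y ≡ m [mod k ] → y ≢ m →
    dist n m ℕ.< dist n y
  strictlyBest-beats {y} (best , unique) 0<y ym y≢m =
    ℕP.≰⇒> λ y≤m → y≢m (unique y 0<y ym (best-transfer y best ym y≤m))

Sign : ℤ → Set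
Sign ε = ε ≡ + 1 ⊎ ε ≡ - (+ 1)

sign-abs : ∀ {ε} → Sign ε → ∣ ε ∣ ≡ 1
sign-abs (inj₁ refl) = refl
sign-abs (inj₂ refl) = refl

-- ε² = 1, in the shape needed for εδ(m) = ε(εkk').
sign-cancel : ∀ {ε} → Sign ε → ∀ a b → ε * (ε * a * b) ≡ a * b
sign-cancel (inj₁ refl) = solve-∀
sign-cancel (inj₂ refl) = solve-∀

-- With n = m² − εkk' and slack c = 2m − (2k' + εk), the neighbour m − εk
-- satisfies −εδ(m − εk) = k(k' + c).
neighbour-identity : ∀ {ε} → Sign ε → ∀ M K K' →
  - ε * ((M - ε * K) * (M - ε * K) - (M * M - ε * K * K'))
    ≡ K * (K' + (+ 2 * M - (+ 2 * K' + ε * K)))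
neighbour-identity (inj₁ refl) = solve-∀
neighbour-identity (inj₂ refl) = solve-∀

-- 4n − (4k'² + k²) = (2m)² − (2k' + εk)² factors through the slack.
discriminant-identity : ∀ {ε} → Sign ε → ∀ M K K' →
  + 4 * (M * M - ε * K * K') - (+ 4 * K' * K' + K * K)
    ≡ (+ 2 * M - (+ 2 * K' + ε * K)) * (+ 2 * M + (+ 2 * K' + ε * K))
discriminant-identity (inj₁ refl) = solve-∀
discriminant-identity (inj₂ refl) = solve-∀

-- The cofactor 2m + 2k' + εk is positive: clear for ε = 1; for ε = −1, if it
-- were ≤ 0 then t = −(2m + 2k' − k) ≥ 0 and
-- 4k² − 4n = 2k² + 2m(k + t + 2k') + 2kt ≥ 0, against k² < n.
cofactor-positive : ∀ {ε} → Sign ε → ∀ {M K K'} → 0ℤ ≤ M → 0ℤ ≤ K' → 0ℤ < K →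
  K * K < M * M - ε * K * K' → 0ℤ < + 2 * M + (+ 2 * K' + ε * K)
cofactor-positive (inj₁ refl) 0≤M 0≤K' 0<K _ =
  ℤP.+-mono-≤-< (*-nonNeg (0≤pos 2) 0≤M)
    (ℤP.+-mono-≤-< (*-nonNeg (0≤pos 2) 0≤K') (subst (0ℤ <_) (sym (ℤP.*-identityˡ _)) 0<K))
cofactor-positive (inj₂ refl) {M} {K} {K'} 0≤M 0≤K' 0<K k²<n = ℤP.≰⇒> λ g≤0 →
  ℤP.<⇒≱ (ℤP.*-monoˡ-<-pos (+ 4) k²<n)
         (≤-by-gap _ (expansion M K K') (expansion-nonNeg (ℤP.neg-mono-≤ g≤0)))
  where
  expansion : ∀ M K K' →
    let t = - (+ 2 * M + (+ 2 * K' + - (+ 1) * K)) in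
    + 4 * (K * K) - + 4 * (M * M - - (+ 1) * K * K')
      ≡ + 2 * (K * K) + + 2 * M * ((K + t) + + 2 * K') + + 2 * K * t
  expansion = solve-∀
  t : ℤ
  t = - (+ 2 * M + (+ 2 * K' + - (+ 1) * K))
  0≤K : 0ℤ ≤ K
  0≤K = ℤP.<⇒≤ 0<K
  0≤2 : 0ℤ ≤ + 2
  0≤2 = 0≤pos 2
  expansion-nonNeg : 0ℤ ≤ t →
    0ℤ ≤ + 2 * (K * K) + + 2 * M * ((K + t) + + 2 * K') + + 2 * K * t
  expansion-nonNeg 0≤t =
    ℤP.+-mono-≤ (ℤP.+-mono-≤ (*-nonNeg 0≤2 (*-nonNeg 0≤K 0≤K)) (*-nonNeg (*-nonNeg 0≤2 0≤M) 0≤factor))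
                (*-nonNeg (*-nonNeg 0≤2 0≤K) 0≤t)
    where
    0≤factor : 0ℤ ≤ (K + t) + + 2 * K'
    0≤factor = ℤP.+-mono-≤ (ℤP.+-mono-≤ 0≤K 0≤t) (*-nonNeg 0≤2 0≤K')

-- Relative to its neighbour b − εk, any other member a of the class of b lies
-- beyond b (ε(a − b) > 0) or beyond the neighbour (−ε(a − (b − εk)) ≥ 0).
sides : ∀ {ε} → Sign ε → ∀ {a b k} → 0 ℕ.< k → a ≡ b [mod k ] → a ≢ b →
  0ℤ < ε * (+ a - + b) ⊎ 0ℤ ≤ - ε * (+ a - (+ b - ε * + k))
sides (inj₁ refl) {a} {b} {k} 0<k ab a≢b = Sum.map far near (class-gap ab a≢b)
  where
  far : + k ≤ + a - + b → 0ℤ < + 1 * (+ a - + b)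
  far k≤ = subst (0ℤ <_) (sym (ℤP.*-identityˡ _)) (ℤP.<-≤-trans (+<+ 0<k) k≤)
  near : + k ≤ - (+ a - + b) → 0ℤ ≤ - (+ 1) * (+ a - (+ b - + 1 * + k))
  near k≤ = subst (0ℤ ≤_) (rearrange (+ a) (+ b) (+ k)) (ℤP.i≤j⇒0≤j-i k≤)
    where
    rearrange : ∀ a b k → - (a - b) - k ≡ - (+ 1) * (a - (b - + 1 * k))
    rearrange = solve-∀
sides (inj₂ refl) {a} {b} {k} 0<k ab a≢b = Sum.swap (Sum.map near far (class-gap ab a≢b))
  where
  far : + k ≤ - (+ a - + b) → 0ℤ < - (+ 1) * (+ a - + b)
  far k≤ = subst (0ℤ <_) (rearrange (+ a) (+ b)) (ℤP.<-≤-trans (+<+ 0<k) k≤)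
    where
    rearrange : ∀ a b → - (a - b) ≡ - (+ 1) * (a - b)
    rearrange = solve-∀
  near : + k ≤ + a - + b → 0ℤ ≤ - (- (+ 1)) * (+ a - (+ b - - (+ 1) * + k))
  near k≤ = subst (0ℤ ≤_) (rearrange (+ a) (+ b) (+ k)) (ℤP.i≤j⇒0≤j-i k≤)
    where
    rearrange : ∀ a b k → (a - b) - k ≡ - (- (+ 1)) * (a - (b - - (+ 1) * k))
    rearrange = solve-∀

neighbour : ∀ {ε} → Sign ε → ∀ {k m} → 0 ℕ.< m → (ε ≡ + 1 → k ℕ.< m) →
  Σ ℕ λ y → 0 ℕ.< y × + y ≡ + m - ε * + k
neighbour (inj₁ refl) {k} {m} _ k<m =
  m ℕ.∸ k , ℕP.m<n⇒0<n∸m (k<m refl) ,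
  (begin
    + (m ℕ.∸ k)    ≡⟨ sym (ℤP.⊖-≥ (ℕP.<⇒≤ (k<m refl))) ⟩
    m ℤ.⊖ k        ≡⟨ sym (ℤP.m-n≡m⊖n m k) ⟩
    + m - + k      ≡⟨ cong (λ i → + m - i) (sym (ℤP.*-identityˡ (+ k))) ⟩
    + m - + 1 * + k ∎)
  where open ≡-Reasoning
neighbour (inj₂ refl) {k} {m} 0<m _ =
  m ℕ.+ k , ℕP.<-≤-trans 0<m (ℕP.m≤m+n m k) , trans (ℤP.pos-+ m k) (rearrange (+ m) (+ k))
  where
  rearrange : ∀ a b → a + b ≡ a - - (+ 1) * b
  rearrange = solve-∀

module Setting (n k k' m : ℕ) {ε : ℤ} (sign : Sign ε)
  (0<k : 0 ℕ.< k) (0<k' : 0 ℕ.< k') (0<m : 0 ℕ.< m) (k²<n : k ℕ.* k ℕ.< n)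
  (hyp : + m * + m - + n ≡ ε * + k * + k') where

  K K' M : ℤ
  K = + k
  K' = + k'
  M = + m

  δ : ℕ → ℤ
  δ x = + x * + x - + n

  slack : ℤ
  slack = + 2 * M - (+ 2 * K' + ε * K)

  n-value : + n ≡ M * M - ε * K * K'
  n-value = trans (reverse (M * M) (+ n)) (cong (λ d → M * M - d) hyp)
    where
    reverse : ∀ a b → b ≡ a - (a - b)
    reverse = solve-∀

  k²<n-ℤ : K * K < M * M - ε * K * K'
  k²<n-ℤ = subst₂ _<_ (ℤP.pos-* k k) n-value (+<+ k²<n)

  -ε-abs : ∣ - ε ∣ ≡ 1
  -ε-abs = trans (ℤP.∣-i∣≡∣i∣ ε) (sign-abs sign)

  dist-m : dist n m ≡ k ℕ.* k'
  dist-m = begin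
    ∣ δ m ∣             ≡⟨ cong ∣_∣ (trans hyp (ℤP.*-assoc ε K K')) ⟩
    ∣ ε * (K * K') ∣    ≡⟨ abs-unit-* ε (sign-abs sign) (K * K') ⟩
    ∣ K * K' ∣          ≡⟨ ℤP.abs-* K K' ⟩
    k ℕ.* k'            ∎
    where open ≡-Reasoning

  dist-m-ℤ : + dist n m ≡ K * K'
  dist-m-ℤ = trans (cong +_ dist-m) (ℤP.pos-* k k')

  ≤-dist-m : ∀ x → K * K' ≤ + dist n x → dist n m ℕ.≤ dist n x
  ≤-dist-m x = ℤP.drop‿+≤+ ∘′ subst (_≤ + dist n x) (sym dist-m-ℤ)

  <-dist-m : ∀ x → K * K' < + dist n x → dist n m ℕ.< dist n x
  <-dist-m x = ℤP.drop‿+<+ ∘′ subst (_< + dist n x) (sym dist-m-ℤ)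

  -- For ε = 1 we have n < m², so k² < n puts k below m.
  k<m-if-above : ε ≡ + 1 → k ℕ.< m
  k<m-if-above ε≡1 = below-root k²<n (ℤP.drop‿+<+ (subst (+ n <_) (sym (ℤP.pos-* m m)) n<m²))
    where
    0<δm : 0ℤ < δ m
    0<δm = subst (0ℤ <_) (sym (trans hyp (cong (λ s → s * K * K') ε≡1)))
                 (*-pos (*-pos {+ 1} (+<+ (ℕ.s≤s ℕ.z≤n)) (+<+ 0<k)) (+<+ 0<k'))
    n<m² : + n < M * M
    n<m² = <-by-gap (δ m) refl 0<δm

  neighbour-of-m : Σ ℕ λ y → 0 ℕ.< y × + y ≡ M - ε * K
  neighbour-of-m = neighbour sign {k} {m} 0<m k<m-if-above

  y : ℕ
  y = proj₁ neighbour-of-m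

  0<y : 0 ℕ.< y
  0<y = proj₁ (proj₂ neighbour-of-m)

  y-value : + y ≡ M - ε * K
  y-value = proj₂ (proj₂ neighbour-of-m)

  y-distance : ∣ + y - M ∣ ≡ k
  y-distance = begin
    ∣ + y - M ∣         ≡⟨ cong (λ i → ∣ i - M ∣) y-value ⟩
    ∣ M - ε * K - M ∣   ≡⟨ cong ∣_∣ (rearrange M (ε * K)) ⟩
    ∣ - (ε * K) ∣       ≡⟨ ℤP.∣-i∣≡∣i∣ (ε * K) ⟩
    ∣ ε * K ∣           ≡⟨ abs-unit-* ε (sign-abs sign) K ⟩
    k                   ∎
    where
    open ≡-Reasoning
    rearrange : ∀ a b → a - b - a ≡ - b
    rearrange = solve-∀

  y≡m : y ≡ m [mod k ]
  y≡m = mod-of-distance {y} {m} y-distance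

  y≢m : y ≢ m
  y≢m y≡m = ℕP.<⇒≢ 0<k (begin
    0                ≡⟨ cong ∣_∣ (sym (ℤP.+-inverseʳ M)) ⟩
    ∣ M - M ∣        ≡⟨ cong (λ z → ∣ + z - M ∣) (sym y≡m) ⟩
    ∣ + y - M ∣      ≡⟨ y-distance ⟩
    k                ∎)
    where open ≡-Reasoning

  y-value-δ : - ε * δ y ≡ K * (K' + slack)
  y-value-δ = trans (cong₂ (λ a b → - ε * (a * a - b)) y-value n-value)
                    (neighbour-identity sign M K K')

  dist-y : dist n y ≡ k ℕ.* ∣ K' + slack ∣
  dist-y = begin
    ∣ δ y ∣             ≡⟨ sym (abs-unit-* (- ε) -ε-abs (δ y)) ⟩
    ∣ - ε * δ y ∣       ≡⟨ cong ∣_∣ y-value-δ ⟩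
    ∣ K * (K' + slack) ∣ ≡⟨ ℤP.abs-* K (K' + slack) ⟩
    k ℕ.* ∣ K' + slack ∣ ∎
    where open ≡-Reasoning

  -- k' + c = (m + y) − k' lies strictly above −k'.
  y-shift : - K' < K' + slack
  y-shift = <-by-gap (M + + y) (trans (rearrange M K K' ε) (cong (λ i → M + i) (sym y-value)))
                     (subst (0ℤ <_) (ℤP.pos-+ m y) (+<+ (ℕP.<-≤-trans 0<m (ℕP.m≤m+n m y))))
    where
    rearrange : ∀ M K K' ε → (K' + (+ 2 * M - (+ 2 * K' + ε * K))) - - K' ≡ M + (M - ε * K)
    rearrange = solve-∀

  far-bound : ∀ x → 0ℤ < ε * (+ x - M) → K * K' < + dist n x
  far-bound x far = begin-strict
    K * K'           ≡⟨ sym (sign-cancel sign K K') ⟩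
    ε * (ε * K * K') ≡⟨ cong (ε *_) (sym hyp) ⟩
    ε * δ m          <⟨ scaled-square-< ε (+ x) M (+ n) far 0<x+m ⟩
    ε * δ x          ≤⟨ unit-*-≤-abs ε (sign-abs sign) (δ x) ⟩
    + ∣ δ x ∣        ∎
    where
    open ℤP.≤-Reasoning
    0<x+m = subst (0ℤ <_) (ℤP.pos-+ x m) (+<+ (ℕP.<-≤-trans 0<m (ℕP.m≤n+m m x)))

  near-bound : ∀ x → 0ℤ ≤ - ε * (+ x - (M - ε * K)) → K * (K' + slack) ≤ + dist n x
  near-bound x near = begin
    K * (K' + slack) ≡⟨ sym y-value-δ ⟩
    - ε * δ y        ≤⟨ scaled-square-≤ (- ε) (+ x) (+ y) (+ n) near' 0≤x+y ⟩
    - ε * δ x        ≤⟨ unit-*-≤-abs (- ε) -ε-abs (δ x) ⟩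
    + ∣ δ x ∣        ∎
    where
    open ℤP.≤-Reasoning
    near' = subst (λ z → 0ℤ ≤ - ε * (+ x - z)) (sym y-value) near
    0≤x+y = subst (0ℤ ≤_) (ℤP.pos-+ x y) (0≤pos (x ℕ.+ y))

  slack-gap : K * (K' + slack) - K * K' ≡ K * slack
  slack-gap = distribute K K' slack
    where
    distribute : ∀ a b c → a * (b + c) - a * b ≡ a * c
    distribute = solve-∀

  best-if-slack : 0ℤ ≤ slack → Best n k m
  best-if-slack 0≤c = best-intro λ x _ xm x≢m → ≤-dist-m x
    (Sum.[ (λ far → ℤP.<⇒≤ (far-bound x far)) , (λ near → ℤP.≤-trans kk'≤ (near-bound x near)) ]
       (sides sign 0<k xm x≢m))
    where
    kk'≤ : K * K' ≤ K * (K' + slack)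
    kk'≤ = ≤-by-gap (K * slack) slack-gap (*-nonNeg (0≤pos k) 0≤c)

  strictlyBest-if-slack : 0ℤ < slack → StrictlyBest n k m
  strictlyBest-if-slack 0<c = strictlyBest-intro 0<m λ x _ xm x≢m → <-dist-m x
    (Sum.[ far-bound x , (λ near → ℤP.<-≤-trans kk'< (near-bound x near)) ] (sides sign 0<k xm x≢m))
    where
    kk'< : K * K' < K * (K' + slack)
    kk'< = <-by-gap (K * slack) slack-gap (*-pos (+<+ 0<k) 0<c)

  -- Step 2: comparing m with its neighbour y forces the sign of c.
  slack-if-best : Best n k m → 0ℤ ≤ slack
  slack-if-best best = nonNeg-shift K' slack (+≤+ k'≤) y-shift
    where
    k'≤ : k' ℕ.≤ ∣ K' + slack ∣
    k'≤ = ℕP.*-cancelˡ-≤ k {{ℕ.>-nonZero 0<k}} (subst₂ ℕ._≤_ dist-m dist-y (best y 0<y y≡m))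

  slack-if-strictlyBest : StrictlyBest n k m → 0ℤ < slack
  slack-if-strictlyBest sb = pos-shift K' slack (+<+ k'<) y-shift
    where
    k'< : k' ℕ.< ∣ K' + slack ∣
    k'< = ℕP.*-cancelˡ-< k _ _ (subst₂ ℕ._<_ dist-m dist-y (strictlyBest-beats sb 0<y y≡m y≢m))

  discriminant : + 4 * + n - (+ 4 * K' * K' + K * K) ≡ slack * (+ 2 * M + (+ 2 * K' + ε * K))
  discriminant = trans (cong (λ i → + 4 * i - (+ 4 * K' * K' + K * K)) n-value)
                       (discriminant-identity sign M K K')

  cofactor>0 : 0ℤ < + 2 * M + (+ 2 * K' + ε * K)
  cofactor>0 = cofactor-positive sign (0≤pos m) (0≤pos k') (+<+ 0<k) k²<n-ℤ

  best⇔slack : Best n k m ⇔ (0ℤ ≤ slack)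
  best⇔slack = mk⇔ slack-if-best best-if-slack

  strictlyBest⇔slack : StrictlyBest n k m ⇔ (0ℤ < slack)
  strictlyBest⇔slack = mk⇔ slack-if-strictlyBest strictlyBest-if-slack

  slack⇔discriminant-≤ : (0ℤ ≤ slack) ⇔ (+ 4 * K' * K' + K * K ≤ + 4 * + n)
  slack⇔discriminant-≤ = ⇔.trans (⇔.sym (proj₁ (sign-of-product cofactor>0)))
    (subst (λ d → (0ℤ ≤ d) ⇔ (+ 4 * K' * K' + K * K ≤ + 4 * + n)) discriminant ≤⇔0≤gap)

  slack⇔discriminant-< : (0ℤ < slack) ⇔ (+ 4 * K' * K' + K * K < + 4 * + n)
  slack⇔discriminant-< = ⇔.trans (⇔.sym (proj₂ (sign-of-product cofactor>0)))
    (subst (λ d → (0ℤ < d) ⇔ (+ 4 * K' * K' + K * K < + 4 * + n)) discriminant <⇔0<gap)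

  slack⇔condition-≤ : (0ℤ ≤ slack) ⇔ (+ 2 * K' + ε * K ≤ + 2 * M)
  slack⇔condition-≤ = ≤⇔0≤gap

  slack⇔condition-< : (0ℤ < slack) ⇔ (+ 2 * K' + ε * K < + 2 * M)
  slack⇔condition-< = <⇔0<gap

proposition1 : (n : ℕ) → 0 ℕ.< n → (∀ (a : ℕ) → a ℕ.* a ≢ n) →
    (k k' m : ℕ) → 0 ℕ.< k → 0 ℕ.< k' → 0 ℕ.< m →
    k ℕ.* k ℕ.< n →
    (ε : ℤ) → (ε ≡ + 1 ⊎ ε ≡ - (+ 1)) →
    (+ m) ℤ.* (+ m) - + n ≡ ε ℤ.* (+ k) ℤ.* (+ k') →
    ((Best n k m ⇔ (+ 4 ℤ.* (+ k') ℤ.* (+ k') ℤ.+ (+ k) ℤ.* (+ k) ℤ.≤ + 4 ℤ.* + n))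
     × (Best n k m ⇔ (+ 2 ℤ.* (+ k') ℤ.+ ε ℤ.* (+ k) ℤ.≤ + 2 ℤ.* (+ m))))
    × ((StrictlyBest n k m ⇔ (+ 4 ℤ.* (+ k') ℤ.* (+ k') ℤ.+ (+ k) ℤ.* (+ k) ℤ.< + 4 ℤ.* + n))
     × (StrictlyBest n k m ⇔ (+ 2 ℤ.* (+ k') ℤ.+ ε ℤ.* (+ k) ℤ.< + 2 ℤ.* (+ m))))
proposition1 n _ _ k k' m 0<k 0<k' 0<m k²<n ε sign hyp =
  (⇔.trans best⇔slack slack⇔discriminant-≤ , ⇔.trans best⇔slack slack⇔condition-≤) ,
  (⇔.trans strictlyBest⇔slack slack⇔discriminant-< , ⇔.trans strictlyBest⇔slack slack⇔condition-<)
  where open Setting n k k' m sign 0<k 0<k' 0<m k²<n hyp
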